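{- For all cathoristic logic formulae $\phi,\psi$ the following are equivalent: (1) for every cathoristic model $\mathfrak{M}$, $\mathfrak{M}\models\phi$ implies $\mathfrak{M}\models\psi$; (2) $\mathrm{Simpl}(\phi)\models\psi$.
   Context: Fix a non-empty set $\Sigma$ of actions. Formulae: $\phi ::= \top \mid \phi\land\psi \mid \langle a\rangle\phi \mid\ !A$ with $a\in\Sigma$, $A$ a finite subset of $\Sigma$. A cathoristic transition system is $\mathcal{L}=(S,\rightarrow,\lambda)$ with $\rightarrow\subseteq S\times\Sigma\times S$ deterministic and $\lambda:S\to\mathcal{P}(\Sigma)$ such that $\{a\mid\exists t.\,s\xrightarrow{a}t\}\subseteq\lambda(s)$ and each $\lambda(s)$ is finite or $\Sigma$; a cathoristic model is $(\mathcal{L},s)$, $s\in S$. Satisfaction: $\top$ always; $\land$ componentwise; $(\mathcal{L},s)\models\langle a\rangle\phi$ iff some $s\xrightarrow{a}t$ has $(\mathcal{L},t)\models\phi$; $(\mathcal{L},s)\models\ !A$ iff $\lambda(s)\subseteq A$. A simulation from $(\mathcal{L}_1,s_1)$ to $(\mathcal{L}_2,s_2)$ is $R\subseteq S_1\times S_2$ containing $(s_1,s_2)$ such that whenever $(x,y)\in R$ and $x\xrightarrow{a}_1x'$ there is $y'$ with $y\xrightarrow{a}_2y'$, $(x',y')\in R$, and $\lambda_1(x)\supseteq\lambda_2(y)$ for all $(x,y)\in R$. $\mathfrak{M}\preceq\mathfrak{M}'$ iff there is a simulation from $\mathfrak{M}'$ to $\mathfrak{M}$; $\simeq$ is $\preceq\cap\preceq^{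 -1}$. Models are considered up to $\simeq$, and a bottom element $\bot$ is added with $\bot\preceq\mathfrak{M}$ for all $\mathfrak{M}$ and $\bot\models\phi$ for all $\phi$; the resulting ordered collection is a bounded lattice, and $\mathrm{glb}$ denotes its binary greatest lower bound. $\mathrm{Simpl}$: $\mathrm{Simpl}(\top)=((\{v\},\emptyset,\{v\mapsto\Sigma\}),v)$; $\mathrm{Simpl}(!A)=((\{v\},\emptyset,\{v\mapsto A\}),v)$; $\mathrm{Simpl}(\phi_1\land\phi_2)=\mathrm{glb}(\mathrm{Simpl}(\phi_1),\mathrm{Simpl}(\phi_2))$; $\mathrm{Simpl}(\langle a\rangle\phi)=\bot$ if $\mathrm{Simpl}(\phi)=\bot$, and otherwise, with $\mathrm{Simpl}(\phi)=((S,\rightarrow,\lambda),w)$, $\mathrm{Simpl}(\langle a\rangle\phi)=((S\cup\{w'\},\rightarrow\cup\{(w',a,w)\},\lambda\cup\{w'\mapsto\Sigma\}),w')$ for a fresh $w'\notin S$. -}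

module Defs where

open import Level using (Level; 0ℓ) renaming (suc to lsuc)
open import Data.Unit using (⊤; tt)
open import Data.Empty using (⊥)
open import Data.Product using (Σ; Σ-syntax; ∃; _×_; _,_)
open import Data.Sum using (_⊎_; inj₁; inj₂)
open import Data.Maybe using (Maybe; just; nothing)
open import Data.List using (List)
open import Data.List.Membership.Propositional using (_∈_)
open import Relation.Binary.PropositionalEquality using (_≡_; refl; trans; sym)

module Cathoristic (Act : Set) where

  -- Formulae of cathoristic logic; A in !A is a finite subset of Act,
  -- represented by a list.
  data Formula : Set where
    ⊤F  : Formula
    _∧F_ : Formula → Formula → Formula
    ⟨_⟩_ : Act → Formula → Formula
    !_   : List Act → Formula

  data Label : Set where
    all : Label
    fin : List Act → Label

  _∈L_ : Act → Label → Set
  a ∈L all   = ⊤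
  a ∈L fin A = a ∈ A

  _⊆L_ : Label → Label → Set
  l ⊆L l' = ∀ a → a ∈L l → a ∈L l'

  record CTS : Set₁ where
    field
      St     : Set
      _⟶[_]_ : St → Act → St → Set
      det    : ∀ {s a t t'} → s ⟶[ a ] t → s ⟶[ a ] t' → t ≡ t'
      lab    : St → Label
      inLab  : ∀ {s a t} → s ⟶[ a ] t → a ∈L lab s
  open CTS public

  record Model : Set₁ where
    constructor ⟪_,_⟫
    field
      lts  : CTS
      root : St lts
  open Model public

  Sat : (L : CTS) → St L → Formula → Set
  Sat L s ⊤F        = ⊤
  Sat L s (φ ∧F ψ)  = Sat L s φ × Sat L s ψ
  Sat L s (⟨ a ⟩ φ) = Σ[ t ∈ St L ] (_⟶[_]_ L s a t × Sat L t φ)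
  Sat L s (! A)     = lab L s ⊆L fin A

  _⊨_ : Model → Formula → Set
  M ⊨ φ = Sat (lts M) (root M) φ

  Simulation : Model → Model → Set₁
  Simulation ⟪ L₁ , s₁ ⟫ ⟪ L₂ , s₂ ⟫ =
    Σ[ R ∈ (St L₁ → St L₂ → Set) ]
      ( R s₁ s₂
      × (∀ {x y a x'} → R x y → _⟶[_]_ L₁ x a x' →
           Σ[ y' ∈ St L₂ ] (_⟶[_]_ L₂ y a y' × R x' y'))
      × (∀ {x y} → R x y → lab L₂ y ⊆L lab L₁ x) )

  _⪯_ : Model → Model → Set₁
  M ⪯ M' = Simulation M' M

  -- Models extended with a bottom element ⊥ (= nothing).
  Model⊥ : Set₁
  Model⊥ = Maybe Model

  _≤⊥_ : Model⊥ → Model⊥ → Set₁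
  nothing ≤⊥ _       = Level.Lift _ ⊤
  just M  ≤⊥ nothing = Level.Lift _ ⊥
  just M  ≤⊥ just M' = M ⪯ M'

  _≈⊥_ : Model⊥ → Model⊥ → Set₁
  m ≈⊥ m' = (m ≤⊥ m') × (m' ≤⊥ m)

  _⊨⊥_ : Model⊥ → Formula → Set
  nothing ⊨⊥ φ = ⊤
  just M  ⊨⊥ φ = M ⊨ φ

  IsGlb : Model⊥ → Model⊥ → Model⊥ → Set₁
  IsGlb m₁ m₂ g =
    (g ≤⊥ m₁) × (g ≤⊥ m₂) × (∀ c → c ≤⊥ m₁ → c ≤⊥ m₂ → c ≤⊥ g)

  single : Label → Model
  single l = ⟪ record
    { St = ⊤ ; _⟶[_]_ = λ _ _ _ → ⊥ ; det = λ () ; lab = λ _ → l ; inLab = λ () }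
    , tt ⟫

  -- Prefixing: a fresh root w' (label Act) with a single a-transition to
  -- the old root w.
  prefix : Act → Model → Model
  prefix a ⟪ L , w ⟫ = ⟪ record
    { St = St L ⊎ ⊤ ; _⟶[_]_ = tr ; det = λ {s} {b} {t} {t'} → dt {s} {b} {t} {t'} ; lab = lb ; inLab = λ {s} {b} {t} → il {s} {b} {t} } , inj₂ tt ⟫
    where
    tr : St L ⊎ ⊤ → Act → St L ⊎ ⊤ → Set
    tr (inj₁ x) b (inj₁ y) = _⟶[_]_ L x b y
    tr (inj₁ x) b (inj₂ _) = ⊥
    tr (inj₂ _) b (inj₁ y) = (b ≡ a) × (y ≡ w)
    tr (inj₂ _) b (inj₂ _) = ⊥
    dt : ∀ {s b t t'} → tr s b t → tr s b t' → t ≡ t'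
    dt {inj₁ x} {b} {inj₁ y} {inj₁ y'} p q with det L p q
    ... | refl = refl
    dt {inj₂ _} {b} {inj₁ y} {inj₁ y'} (_ , refl) (_ , refl) = refl
    lb : St L ⊎ ⊤ → Label
    lb (inj₁ x) = lab L x
    lb (inj₂ _) = all
    il : ∀ {s b t} → tr s b t → b ∈L lb s
    il {inj₁ x} {b} {inj₁ y} p = inLab L p
    il {inj₂ _} {b} {inj₁ y} p = tt

  prefix⊥ : Act → Model⊥ → Model⊥
  prefix⊥ a nothing  = nothing
  prefix⊥ a (just M) = just (prefix a M)

  -- IsSimpl φ m : m is (a representative of the ≃-class) Simpl(φ).
  IsSimpl : Formula → Model⊥ → Set₁
  IsSimpl ⊤F       m = m ≈⊥ just (single all)
  IsSimpl (! A)    m = m ≈⊥ just (single (fin A))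
  IsSimpl (φ ∧F ψ) m =
    Σ[ m₁ ∈ Model⊥ ] Σ[ m₂ ∈ Model⊥ ]
      (IsSimpl φ m₁ × IsSimpl ψ m₂ × IsGlb m₁ m₂ m)
  IsSimpl (⟨ a ⟩ φ) m = Σ[ m₁ ∈ Model⊥ ] (IsSimpl φ m₁ × m ≈⊥ prefix⊥ a m₁)

module Submission where

-- Simpl(φ) is the characteristic model of φ: it satisfies φ and lies above
-- every model of φ in the simulation order.  Since satisfaction is preserved
-- downwards along simulations, entailment φ ⊨ ψ is then the same as
-- Simpl(φ) ⊨ ψ.
--
-- For part 2 the only obstacle is the existence of glbs.  Given decidable
-- equality on actions, we build a characteristic model for every formula:
-- its states are words, a word p can do a when φ requires it, and the label
-- at p is the bound φ puts there.  If some required action falls outside its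
-- label, φ is unsatisfiable and ⊥ is characteristic.  The characteristic
-- model of φ ∧ ψ is then the glb of those of φ and ψ.

open import Defs
open import Data.Product using (Σ-syntax; _×_)
open import Relation.Binary.Definitions using (DecidableEquality)
open import Function.Bundles using (_⇔_)

open import Level using (lift)
open import Data.Unit using (⊤; tt)
open import Data.Empty using (⊥; ⊥-elim)
open import Data.Product using (_,_; proj₁; proj₂)
open import Data.Sum using (_⊎_; inj₁; inj₂)
open import Data.Maybe using (just; nothing)
open import Data.List using (List; []; _∷_; _++_; map; filter)
open import Data.List.Relation.Unary.Any using (Any; here; there; any?; satisfied)
open import Data.List.Membership.Propositional using (_∈_; lose; find)
open import Data.List.Membership.Propositional.Properties
  using (∈-map⁺; ∈-++⁺ˡ; ∈-++⁺ʳ; ∈-++⁻; ∈-filter⁺; ∈-filter⁻)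
open import Data.List.Properties using (++-assoc; ++-identityʳ)
open import Relation.Binary.PropositionalEquality using (_≡_; refl; sym; subst)
open import Relation.Nullary using (Dec; yes; no; ¬_)
open import Relation.Nullary.Decidable using (¬?)
open import Function.Bundles using (mk⇔)

module CathoristicTheory (Act : Set) where
  open Cathoristic Act

  simulation-preserves-Sat : (L₁ L₂ : CTS) (R : St L₁ → St L₂ → Set)
    → (∀ {x y a x'} → R x y → _⟶[_]_ L₁ x a x' →
           Σ[ y' ∈ St L₂ ] (_⟶[_]_ L₂ y a y' × R x' y'))
    → (∀ {x y} → R x y → lab L₂ y ⊆L lab L₁ x)
    → ∀ χ {x y} → R x y → Sat L₁ x χ → Sat L₂ y χ
  simulation-preserves-Sat L₁ L₂ R step bound = go
    where
    go : ∀ χ {x y} → R x y → Sat L₁ x χ → Sat L₂ y χ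
    go ⊤F r _ = tt
    go (χ ∧F χ') r (s , s') = go χ r s , go χ' r s'
    go (⟨ a ⟩ χ) r (t , x⟶t , s) =
      let (y' , y⟶y' , r') = step r x⟶t in y' , y⟶y' , go χ r' s
    go (! A) r s = λ b b∈ → s b (bound r b b∈)

  ⪯-sound : ∀ {M M'} → M ⪯ M' → ∀ φ → M' ⊨ φ → M ⊨ φ
  ⪯-sound {M} {M'} (R , root-related , step , bound) φ =
    simulation-preserves-Sat (lts M') (lts M) R step bound φ root-related

  ≤⊥-sound : ∀ {m m'} → m ≤⊥ m' → ∀ φ → m' ⊨⊥ φ → m ⊨⊥ φ
  ≤⊥-sound {nothing} _ φ _ = tt
  ≤⊥-sound {just M} {just M'} M⪯M' φ = ⪯-sound {M} {M'} M⪯M' φ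

  simulation-compose : ∀ {M₁ M₂ M₃} →
    Simulation M₁ M₂ → Simulation M₂ M₃ → Simulation M₁ M₃
  simulation-compose {M₁} {M₂} {M₃} (R , r₀ , step , bound) (R' , r₀' , step' , bound') =
    (λ x z → Σ[ y ∈ St (lts M₂) ] (R x y × R' y z)) , (root M₂ , r₀ , r₀') ,
    (λ { (y , r , r') x⟶x' →
           let (y' , y⟶y' , rr) = step r x⟶x'
               (z' , z⟶z' , rr') = step' r' y⟶y'
           in z' , z⟶z' , (y' , rr , rr') }) ,
    (λ { (y , r , r') b b∈ → bound r b (bound' r' b b∈) })

  ≤⊥-trans : ∀ {m₁ m₂ m₃} → m₁ ≤⊥ m₂ → m₂ ≤⊥ m₃ → m₁ ≤⊥ m₃
  ≤⊥-trans {nothing} _ _ = lift tt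
  ≤⊥-trans {just M₁} {just M₂} {just M₃} p q = simulation-compose {M₃} {M₂} {M₁} q p

  ≤⊥-refl : ∀ m → m ≤⊥ m
  ≤⊥-refl nothing = lift tt
  ≤⊥-refl (just M) =
    (λ x y → x ≡ y) , refl , (λ { refl x⟶x' → _ , x⟶x' , refl }) , (λ { refl b b∈ → b∈ })

  ⊨⊥-∧ : ∀ {φ ψ} m → m ⊨⊥ φ → m ⊨⊥ ψ → m ⊨⊥ (φ ∧F ψ)
  ⊨⊥-∧ nothing _ _ = tt
  ⊨⊥-∧ (just M) s t = s , t

  Characteristic : Formula → Model⊥ → Set₁
  Characteristic φ m = (m ⊨⊥ φ) × (∀ M → M ⊨ φ → just M ≤⊥ m)

  characteristic-above : ∀ {φ m} → Characteristic φ m → ∀ c → c ⊨⊥ φ → c ≤⊥ m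
  characteristic-above _ nothing _ = lift tt
  characteristic-above (_ , greatest) (just M) s = greatest M s

  characteristic-entailment : ∀ {φ m} → Characteristic φ m → ∀ ψ →
    ((M : Model) → M ⊨ φ → M ⊨ ψ) ⇔ (m ⊨⊥ ψ)
  characteristic-entailment {φ} {m} (sat , greatest) ψ =
    mk⇔ (entailed m sat) (λ t M s → ≤⊥-sound (greatest M s) ψ t)
    where
    entailed : ∀ m → m ⊨⊥ φ → ((M : Model) → M ⊨ φ → M ⊨ ψ) → m ⊨⊥ ψ
    entailed nothing _ _ = tt
    entailed (just M) s f = f M s

  characteristic-≈ : ∀ {φ m m'} → Characteristic φ m → m ≈⊥ m' → Characteristic φ m'
  characteristic-≈ {φ} {m} {m'} (sat , greatest) (m≤m' , m'≤m) =
    ≤⊥-sound m'≤m φ sat , λ M s → ≤⊥-trans {just M} (greatest M s) m≤m'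

  below-single : ∀ M l → lab (lts M) (root M) ⊆L l → just M ≤⊥ just (single l)
  below-single M l root⊆l =
    (λ _ y → y ≡ root M) , refl , (λ _ ()) , (λ { refl → root⊆l })

  single-all-characteristic : Characteristic ⊤F (just (single all))
  single-all-characteristic = tt , λ M _ → below-single M all (λ _ _ → tt)

  single-fin-characteristic : ∀ A → Characteristic (! A) (just (single (fin A)))
  single-fin-characteristic A = (λ _ b∈ → b∈) , λ M s → below-single M (fin A) s

  -- The old states sit inside the prefixed system unchanged, so satisfaction
  -- at the old root w survives prefixing.
  prefix-embeds : ∀ a L w φ → Sat L w φ → Sat (lts (prefix a ⟪ L , w ⟫)) (inj₁ w) φ
  prefix-embeds a L w φ = simulation-preserves-Sat L L' R step bound φ refl
    where
    L' = lts (prefix a ⟪ L , w ⟫)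
    R : St L → St L ⊎ ⊤ → Set
    R x (inj₁ y) = x ≡ y
    R x (inj₂ _) = ⊥
    step : ∀ {x y b x'} → R x y → _⟶[_]_ L x b x' →
           Σ[ y' ∈ St L ⊎ ⊤ ] (_⟶[_]_ L' y b y' × R x' y')
    step {y = inj₁ y} refl x⟶x' = inj₁ _ , x⟶x' , refl
    bound : ∀ {x y} → R x y → lab L' y ⊆L lab L x
    bound {y = inj₁ y} refl b b∈ = b∈

  -- If s ⟶a t and (L, t) ⪯ M₁, then (L, s) ⪯ prefix a M₁: relate the new
  -- root to s and keep the old simulation.
  prefix-monotone : ∀ a L s t M₁ → _⟶[_]_ L s a t → just ⟪ L , t ⟫ ≤⊥ just M₁ →
                    just ⟪ L , s ⟫ ≤⊥ just (prefix a M₁)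
  prefix-monotone a L s t M₁ s⟶t (R , r₀ , step , bound) =
    R' , refl , (λ {x} {y} {b} {x'} → step' {x} {y} {b} {x'}) , (λ {x} {y} → bound' {x} {y})
    where
    L₁' = lts (prefix a M₁)
    R' : St L₁' → St L → Set
    R' (inj₁ x) y = R x y
    R' (inj₂ _) y = y ≡ s
    step' : ∀ {x y b x'} → R' x y → _⟶[_]_ L₁' x b x' →
            Σ[ y' ∈ St L ] (_⟶[_]_ L y b y' × R' x' y')
    step' {inj₁ x} {x' = inj₁ _} r x⟶x' = step r x⟶x'
    step' {inj₂ _} {x' = inj₁ _} refl (refl , refl) = t , s⟶t , r₀
    bound' : ∀ {x y} → R' x y → lab L y ⊆L lab L₁' x
    bound' {inj₁ x} r = bound r
    bound' {inj₂ _} r b _ = tt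

  prefix-characteristic : ∀ a {φ m} → Characteristic φ m →
                          Characteristic (⟨ a ⟩ φ) (prefix⊥ a m)
  prefix-characteristic a {φ} {m} (sat , greatest) = sat' m sat , greatest' m greatest
    where
    sat' : ∀ m → m ⊨⊥ φ → prefix⊥ a m ⊨⊥ (⟨ a ⟩ φ)
    sat' nothing _ = tt
    sat' (just ⟪ L , w ⟫) s = inj₁ w , (refl , refl) , prefix-embeds a L w φ s
    greatest' : ∀ m → (∀ M → M ⊨ φ → just M ≤⊥ m) →
                ∀ M → M ⊨ (⟨ a ⟩ φ) → just M ≤⊥ prefix⊥ a m
    greatest' nothing g ⟪ L , s ⟫ (t , _ , st) = g ⟪ L , t ⟫ st
    greatest' (just M₁) g ⟪ L , s ⟫ (t , s⟶t , st) =
      prefix-monotone a L s t M₁ s⟶t (g ⟪ L , t ⟫ st)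

  glb-characteristic : ∀ {φ ψ m₁ m₂ m} → Characteristic φ m₁ → Characteristic ψ m₂ →
                       IsGlb m₁ m₂ m → Characteristic (φ ∧F ψ) m
  glb-characteristic {φ} {ψ} {m = m} (sat₁ , greatest₁) (sat₂ , greatest₂) (m≤m₁ , m≤m₂ , below) =
    ⊨⊥-∧ m (≤⊥-sound m≤m₁ φ sat₁) (≤⊥-sound m≤m₂ ψ sat₂) ,
    λ M (s , t) → below (just M) (greatest₁ M s) (greatest₂ M t)

  -- Conversely, a characteristic model of φ ∧ ψ is the glb of characteristic
  -- models of φ and ψ: the lower bounds of both are exactly the models of φ ∧ ψ.
  characteristic-glb : ∀ {φ ψ m₁ m₂ m} → Characteristic φ m₁ → Characteristic ψ m₂ →
                       Characteristic (φ ∧F ψ) m → IsGlb m₁ m₂ m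
  characteristic-glb {φ} {ψ} {m = m} c₁@(sat₁ , _) c₂@(sat₂ , _) c@(sat , _) =
    characteristic-above c₁ m (conjunct₁ m sat) ,
    characteristic-above c₂ m (conjunct₂ m sat) ,
    λ k k≤m₁ k≤m₂ →
      characteristic-above c k (⊨⊥-∧ k (≤⊥-sound k≤m₁ φ sat₁) (≤⊥-sound k≤m₂ ψ sat₂))
    where
    conjunct₁ : ∀ m → m ⊨⊥ (φ ∧F ψ) → m ⊨⊥ φ
    conjunct₁ nothing _ = tt
    conjunct₁ (just _) = proj₁
    conjunct₂ : ∀ m → m ⊨⊥ (φ ∧F ψ) → m ⊨⊥ ψ
    conjunct₂ nothing _ = tt
    conjunct₂ (just _) = proj₂

  simpl-characteristic : ∀ φ m → IsSimpl φ m → Characteristic φ m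
  simpl-characteristic ⊤F m (m≤ , ≤m) =
    characteristic-≈ single-all-characteristic (≤m , m≤)
  simpl-characteristic (! A) m (m≤ , ≤m) =
    characteristic-≈ (single-fin-characteristic A) (≤m , m≤)
  simpl-characteristic (φ ∧F ψ) m (m₁ , m₂ , simpl₁ , simpl₂ , glb) =
    glb-characteristic (simpl-characteristic φ m₁ simpl₁)
                       (simpl-characteristic ψ m₂ simpl₂) glb
  simpl-characteristic (⟨ a ⟩ φ) m (m₁ , simpl₁ , m≤ , ≤m) =
    characteristic-≈ (prefix-characteristic a (simpl-characteristic φ m₁ simpl₁)) (≤m , m≤)

  Path : (L : CTS) → St L → List Act → St L → Set
  Path L x [] y = x ≡ y
  Path L x (a ∷ p) y = Σ[ z ∈ St L ] (_⟶[_]_ L x a z × Path L z p y)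

  path-unsnoc : ∀ L {x y' a} p → Path L x (p ++ (a ∷ [])) y' →
                Σ[ y ∈ St L ] (Path L x p y × _⟶[_]_ L y a y')
  path-unsnoc L [] (z , x⟶z , refl) = _ , refl , x⟶z
  path-unsnoc L (b ∷ p) (z , x⟶z , P) =
    let (y , P' , y⟶y') = path-unsnoc L p P in y , (z , x⟶z , P') , y⟶y'

  path-deterministic : ∀ L {x y y'} p → Path L x p y → Path L x p y' → y ≡ y'
  path-deterministic L [] refl refl = refl
  path-deterministic L (b ∷ p) (z , x⟶z , P) (z' , x⟶z' , P') with det L x⟶z x⟶z'
  ... | refl = path-deterministic L p P P'

  module CanonicalModel (_≟_ : DecidableEquality Act) where
    open import Data.List.Membership.DecPropositional _≟_ using (_∈?_)

    meet : Label → Label → Label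
    meet all l = l
    meet (fin A) all = fin A
    meet (fin A) (fin B) = fin (filter (_∈? B) A)

    meet-⊆ˡ : ∀ l₁ l₂ → meet l₁ l₂ ⊆L l₁
    meet-⊆ˡ all l b b∈ = tt
    meet-⊆ˡ (fin A) all b b∈ = b∈
    meet-⊆ˡ (fin A) (fin B) b b∈ = proj₁ (∈-filter⁻ (_∈? B) {xs = A} b∈)

    meet-⊆ʳ : ∀ l₁ l₂ → meet l₁ l₂ ⊆L l₂
    meet-⊆ʳ all l b b∈ = b∈
    meet-⊆ʳ (fin A) all b b∈ = tt
    meet-⊆ʳ (fin A) (fin B) b b∈ = proj₂ (∈-filter⁻ (_∈? B) {xs = A} b∈)

    meet-greatest : ∀ l l₁ l₂ → l ⊆L l₁ → l ⊆L l₂ → l ⊆L meet l₁ l₂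
    meet-greatest l all l₂ _ q = q
    meet-greatest l (fin A) all p _ = p
    meet-greatest l (fin A) (fin B) p q b b∈ = ∈-filter⁺ (_∈? B) (p b b∈) (q b b∈)

    _∈L?_ : ∀ a l → Dec (a ∈L l)
    a ∈L? all = yes tt
    a ∈L? fin A = a ∈? A

    -- required φ p: the actions φ forces to be enabled after the word p.
    required : Formula → List Act → List Act
    required ⊤F p = []
    required (! A) p = []
    required (φ ∧F ψ) p = required φ p ++ required ψ p
    required (⟨ b ⟩ φ) [] = b ∷ []
    required (⟨ b ⟩ φ) (c ∷ p) with c ≟ b
    ... | yes _ = required φ p
    ... | no _ = []

    -- allowed φ p: the bound φ puts on the label reached by the word p.
    allowed : Formula → List Act → Label
    allowed ⊤F p = all
    allowed (! A) [] = fin A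
    allowed (! A) (_ ∷ _) = all
    allowed (φ ∧F ψ) p = meet (allowed φ p) (allowed ψ p)
    allowed (⟨ b ⟩ φ) [] = all
    allowed (⟨ b ⟩ φ) (c ∷ p) with c ≟ b
    ... | yes _ = allowed φ p
    ... | no _ = all

    -- A finite list of words covering all those where φ requires something.
    relevant : Formula → List (List Act)
    relevant ⊤F = [] ∷ []
    relevant (! A) = [] ∷ []
    relevant (φ ∧F ψ) = relevant φ ++ relevant ψ
    relevant (⟨ b ⟩ φ) = [] ∷ map (b ∷_) (relevant φ)

    required⇒relevant : ∀ φ p {a} → a ∈ required φ p → p ∈ relevant φ
    required⇒relevant (φ ∧F ψ) p a∈ with ∈-++⁻ (required φ p) a∈
    ... | inj₁ a∈φ = ∈-++⁺ˡ (required⇒relevant φ p a∈φ)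
    ... | inj₂ a∈ψ = ∈-++⁺ʳ (relevant φ) (required⇒relevant ψ p a∈ψ)
    required⇒relevant (⟨ b ⟩ φ) [] _ = here refl
    required⇒relevant (⟨ b ⟩ φ) (c ∷ p) a∈ with c ≟ b
    ... | yes refl = there (∈-map⁺ (b ∷_) (required⇒relevant φ p a∈))

    required-⟨⟩ : ∀ b φ q {a} → a ∈ required φ q → a ∈ required (⟨ b ⟩ φ) (b ∷ q)
    required-⟨⟩ b φ q a∈ with b ≟ b
    ... | yes _ = a∈
    ... | no b≢b = ⊥-elim (b≢b refl)

    allowed-⟨⟩ : ∀ b φ q → allowed (⟨ b ⟩ φ) (b ∷ q) ⊆L allowed φ q
    allowed-⟨⟩ b φ q with b ≟ b
    ... | yes _ = λ c c∈ → c∈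
    ... | no b≢b = ⊥-elim (b≢b refl)

    required-reachable : ∀ L χ {x} p {a} → Sat L x χ → a ∈ required χ p →
                         Σ[ y ∈ St L ] Path L x (p ++ (a ∷ [])) y
    required-reachable L (χ ∧F χ') p (s , s') a∈ with ∈-++⁻ (required χ p) a∈
    ... | inj₁ a∈χ = required-reachable L χ p s a∈χ
    ... | inj₂ a∈χ' = required-reachable L χ' p s' a∈χ'
    required-reachable L (⟨ b ⟩ χ) [] (t , x⟶t , _) (here refl) = t , t , x⟶t , refl
    required-reachable L (⟨ b ⟩ χ) (c ∷ p) (t , x⟶t , s) a∈ with c ≟ b
    ... | yes refl = let (y , P) = required-reachable L χ p s a∈ in y , t , x⟶t , P

    label-allowed : ∀ L χ {x y} p → Sat L x χ → Path L x p y → lab L y ⊆L allowed χ p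
    label-allowed L ⊤F p s P c _ = tt
    label-allowed L (! A) [] s refl = s
    label-allowed L (! A) (_ ∷ _) s P c _ = tt
    label-allowed L (χ ∧F χ') p (s , s') P =
      meet-greatest _ (allowed χ p) (allowed χ' p)
        (label-allowed L χ p s P) (label-allowed L χ' p s' P)
    label-allowed L (⟨ b ⟩ χ) [] s P c _ = tt
    label-allowed L (⟨ b ⟩ χ) (c ∷ p) (t , x⟶t , s) (z , x⟶z , P) with c ≟ b
    ... | no _ = λ _ _ → tt
    ... | yes refl with det L x⟶t x⟶z
    ...   | refl = label-allowed L χ p s P

    Consistent : Formula → Set
    Consistent φ = ∀ p {a} → a ∈ required φ p → a ∈L allowed φ p

    Conflict : Formula → Set
    Conflict φ =
      Any (λ p → Any (λ a → ¬ (a ∈L allowed φ p)) (required φ p)) (relevant φ)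

    conflict? : ∀ φ → Dec (Conflict φ)
    conflict? φ =
      any? (λ p → any? (λ a → ¬? (a ∈L? allowed φ p)) (required φ p)) (relevant φ)

    no-conflict⇒consistent : ∀ φ → ¬ Conflict φ → Consistent φ
    no-conflict⇒consistent φ no-conflict p {a} a∈ with a ∈L? allowed φ p
    ... | yes ok = ok
    ... | no a∉ = ⊥-elim (no-conflict (lose (required⇒relevant φ p a∈) (lose a∈ a∉)))

    conflict-unsatisfiable : ∀ φ → Conflict φ → ∀ M → ¬ (M ⊨ φ)
    conflict-unsatisfiable φ conflict ⟪ L , x ⟫ s =
      let (p , conflict-at-p) = satisfied conflict
          (a , a∈ , a∉) = find conflict-at-p
          (y' , P') = required-reachable L φ p s a∈
          (y , P , y⟶y') = path-unsnoc L p P'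
      in a∉ (label-allowed L φ p s P a (inLab L y⟶y'))

    -- States are words; p ⟶a p·a exactly when φ requires a after p.
    canonical-CTS : ∀ φ → Consistent φ → CTS
    canonical-CTS φ consistent = record
      { St = List Act
      ; _⟶[_]_ = λ p a q → (a ∈ required φ p) × (q ≡ p ++ (a ∷ []))
      ; det = λ { (_ , refl) (_ , refl) → refl }
      ; lab = allowed φ
      ; inLab = λ { {p} (a∈ , _) → consistent p a∈ } }

    -- The word p of the canonical model of φ satisfies every χ whose demands
    -- after p are already demands of φ after p.
    canonical-satisfies : ∀ φ consistent χ p →
      (∀ q {a} → a ∈ required χ q → a ∈ required φ (p ++ q)) →
      (∀ q → allowed φ (p ++ q) ⊆L allowed χ q) →
      Sat (canonical-CTS φ consistent) p χ
    canonical-satisfies φ c ⊤F p req bnd = tt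
    canonical-satisfies φ c (χ ∧F χ') p req bnd =
      canonical-satisfies φ c χ p (λ q a∈ → req q (∈-++⁺ˡ a∈))
        (λ q b b∈ → meet-⊆ˡ (allowed χ q) (allowed χ' q) b (bnd q b b∈)) ,
      canonical-satisfies φ c χ' p (λ q a∈ → req q (∈-++⁺ʳ (required χ q) a∈))
        (λ q b b∈ → meet-⊆ʳ (allowed χ q) (allowed χ' q) b (bnd q b b∈))
    canonical-satisfies φ c (⟨ b ⟩ χ) p req bnd =
      p·b , (b-required , refl) , canonical-satisfies φ c χ p·b req' bnd'
      where
      p·b = p ++ (b ∷ [])
      b-required : b ∈ required φ p
      b-required = subst (λ r → b ∈ required φ r) (++-identityʳ p) (req [] (here refl))
      req' : ∀ q {a} → a ∈ required χ q → a ∈ required φ (p·b ++ q)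
      req' q a∈ = subst (λ r → _ ∈ required φ r) (sym (++-assoc p (b ∷ []) q))
                        (req (b ∷ q) (required-⟨⟩ b χ q a∈))
      bnd' : ∀ q → allowed φ (p·b ++ q) ⊆L allowed χ q
      bnd' q a a∈ = allowed-⟨⟩ b χ q a
        (bnd (b ∷ q) a (subst (λ r → a ∈L allowed φ r) (++-assoc p (b ∷ []) q) a∈))
    canonical-satisfies φ c (! A) p req bnd a a∈ =
      bnd [] a (subst (λ r → a ∈L allowed φ r) (sym (++-identityʳ p)) a∈)

    -- Any model of φ is simulated by the canonical model via
    -- "p relates to the state reached along p".
    canonical-greatest : ∀ φ consistent M → M ⊨ φ →
                         just M ≤⊥ just ⟪ canonical-CTS φ consistent , [] ⟫
    canonical-greatest φ consistent ⟪ L , x ⟫ s =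
      (λ p y → Path L x p y) , refl ,
      (λ { {p} P (a∈ , refl) → step p P a∈ }) ,
      (λ { {p} P → label-allowed L φ p s P })
      where
      step : ∀ p {y a} → Path L x p y → a ∈ required φ p →
             Σ[ y' ∈ St L ] (_⟶[_]_ L y a y' × Path L x (p ++ (a ∷ [])) y')
      step p P a∈ with required-reachable L φ p s a∈
      ... | y' , P' with path-unsnoc L p P'
      ...   | y₀ , P₀ , y₀⟶y' with path-deterministic L p P₀ P
      ...     | refl = y' , y₀⟶y' , P'

    characteristic-exists : ∀ φ → Σ[ m ∈ Model⊥ ] Characteristic φ m
    characteristic-exists φ with conflict? φ
    ... | yes conflict =
      nothing , tt , λ M s → ⊥-elim (conflict-unsatisfiable φ conflict M s)
    ... | no no-conflict =
      just ⟪ canonical-CTS φ consistent , [] ⟫ ,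
      canonical-satisfies φ consistent φ [] (λ _ a∈ → a∈) (λ _ _ a∈ → a∈) ,
      canonical-greatest φ consistent
      where
      consistent = no-conflict⇒consistent φ no-conflict

    -- Hence Simpl(φ) exists: the only nontrivial clause, conjunction, takes
    -- the characteristic model of φ ∧ ψ as the required glb.
    simpl-exists : ∀ φ → Σ[ m ∈ Model⊥ ] IsSimpl φ m
    simpl-exists ⊤F = just (single all) , ≤⊥-refl (just (single all)) , ≤⊥-refl (just (single all))
    simpl-exists (! A) =
      just (single (fin A)) , ≤⊥-refl (just (single (fin A))) , ≤⊥-refl (just (single (fin A)))
    simpl-exists (⟨ a ⟩ φ) =
      let (m₁ , simpl₁) = simpl-exists φ
      in prefix⊥ a m₁ , m₁ , simpl₁ , ≤⊥-refl (prefix⊥ a m₁) , ≤⊥-refl (prefix⊥ a m₁)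
    simpl-exists (φ ∧F ψ) =
      let (m₁ , simpl₁) = simpl-exists φ
          (m₂ , simpl₂) = simpl-exists ψ
          (m , c) = characteristic-exists (φ ∧F ψ)
      in m , m₁ , m₂ , simpl₁ , simpl₂ ,
         characteristic-glb (simpl-characteristic φ m₁ simpl₁)
                            (simpl-characteristic ψ m₂ simpl₂) c

mainTheorem7 : (Act : Set) → Act → (φ ψ : Cathoristic.Formula Act) →
    ((m : Cathoristic.Model⊥ Act) → Cathoristic.IsSimpl Act φ m →
      ((M : Cathoristic.Model Act) → Cathoristic._⊨_ Act M φ → Cathoristic._⊨_ Act M ψ)
        ⇔ Cathoristic._⊨⊥_ Act m ψ)
    × (DecidableEquality Act → Σ[ m ∈ Cathoristic.Model⊥ Act ] Cathoristic.IsSimpl Act φ m)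
mainTheorem7 Act _ φ ψ =
  (λ m simpl → characteristic-entailment (simpl-characteristic φ m simpl) ψ) ,
  (λ _≟_ → CanonicalModel.simpl-exists _≟_ φ)
  where
  open CathoristicTheory Act
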